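{- Let $G=(V,E)$ be a simple graph and let $m$ be an integer with $|V|+1\le m\le 2|V|$. Let $G_m$ be the complete graph on vertex set $V\cup S$, where $S$ is a set of $m$ new vertices, with edge weights: each edge of $E$ has weight $0$; each pair of vertices of $V$ not in $E$ (a non-edge) has weight $M$; each edge between two vertices of $S$ has weight $N$; each edge between a vertex of $V$ and a vertex of $S$ has weight $L$; here $N=2L$ and $M$ is much larger than $N$ and $L$. Then a tour $T$ in $G_m$ is 2-optimal if and only if $T$ contains no non-edge.
   Context: A tour is a Hamiltonian cycle; its weight is the sum of its edge weights. A 2-change on a tour $T$ removes two non-adjacent edges of $T$ and adds the unique pair of edges not in $T$ that reconnects the two resulting paths into a new tour. A tour is 2-optimal if no 2-change yields a tour of strictly smaller weight. -}

module Defs where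

open import Data.Nat using (ℕ; zero; suc; _+_; _*_; _≤_; _<_; s≤s; s≤s⁻¹)
open import Data.Nat.Properties using (≤∧≢⇒<)
import Data.Nat as ℕ
open import Data.Fin using (Fin; zero; suc; toℕ; fromℕ<)
open import Data.Fin.Properties using (toℕ<n)
open import Data.Bool using (Bool; true; false; if_then_else_)
open import Data.Sum using (_⊎_; inj₁; inj₂)
open import Data.Product using (Σ; ∃; _×_; _,_)
open import Data.List using (tabulate)
open import Data.Nat.ListAction using (sum)
open import Relation.Binary.PropositionalEquality using (_≡_; _≢_)
open import Relation.Nullary using (¬_; yes; no)
open import Function.Definitions using (Bijective)
open import Function.Bundles using (_⇔_)

record SimpleGraph (n : ℕ) : Set where
  field
    adj    : Fin n → Fin n → Bool
    sym    : ∀ x y → adj x y ≡ adj y x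
    irrefl : ∀ x → adj x x ≡ false
open SimpleGraph public

Vertex : ℕ → ℕ → Set
Vertex n m = Fin n ⊎ Fin m

weight : ∀ {n m} → SimpleGraph n → (L M : ℕ) → Vertex n m → Vertex n m → ℕ
weight G L M (inj₁ x) (inj₁ y) = if adj G x y then 0 else M
weight G L M (inj₁ x) (inj₂ s) = L
weight G L M (inj₂ s) (inj₁ x) = L
weight G L M (inj₂ s) (inj₂ s') = 2 * L

csuc : ∀ {k} → Fin k → Fin k
csuc {suc k} i with toℕ i ℕ.≟ k
... | yes _ = zero
... | no ne = fromℕ< (s≤s (≤∧≢⇒< (s≤s⁻¹ (toℕ<n i)) ne))

-- A tour (Hamiltonian cycle) of the complete graph on Vertex n m, given as a
-- cyclic ordering: a bijection from positions Fin (n + m) to the vertices;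
-- its edges join the vertices at positions i and i+1 (mod n+m).
Tour : ℕ → ℕ → Set
Tour n m = Σ (Fin (n + m) → Vertex n m) (Bijective _≡_ _≡_)

TEdge : ∀ {n m} → Tour n m → Vertex n m → Vertex n m → Set
TEdge {n} {m} (t , _) u v =
  ∃ λ (i : Fin (n + m)) → (t i ≡ u × t (csuc i) ≡ v) ⊎ (t i ≡ v × t (csuc i) ≡ u)

tourWeight : ∀ {n m} → (Vertex n m → Vertex n m → ℕ) → Tour n m → ℕ
tourWeight w (t , _) = sum (tabulate λ i → w (t i) (t (csuc i)))

SameEdge : ∀ {A : Set} → A → A → A → A → Set
SameEdge u v a b = (u ≡ a × v ≡ b) ⊎ (u ≡ b × v ≡ a)

-- T' arises from T by a 2-change: remove the two non-adjacent (vertex-disjoint)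
-- tour edges {a,b}, {c,d} and add the edges {a,c}, {b,d} (not in T), the result
-- being a tour.  (The other reconnection {a,d},{b,c} is covered by swapping c,d.)
TwoChange : ∀ {n m} → Tour n m → Tour n m → Set
TwoChange {n} {m} T T' =
  ∃ λ (a : Vertex n m) → ∃ λ b → ∃ λ c → ∃ λ d →
    TEdge T a b × TEdge T c d ×
    a ≢ c × a ≢ d × b ≢ c × b ≢ d ×
    ¬ TEdge T a c × ¬ TEdge T b d ×
    (∀ u v → TEdge T' u v ⇔
       ((TEdge T u v × ¬ SameEdge u v a b × ¬ SameEdge u v c d)
        ⊎ SameEdge u v a c ⊎ SameEdge u v b d))

TwoOptimal : ∀ {n m} → (Vertex n m → Vertex n m → ℕ) → Tour n m → Set
TwoOptimal w T = ∀ T' → TwoChange T T' → ¬ (tourWeight w T' < tourWeight w T)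

NoNonEdge : ∀ {n m} → SimpleGraph n → Tour n m → Set
NoNonEdge {n} {m} G T = ∀ (x y : Fin n) → TEdge {n} {m} T (inj₁ x) (inj₁ y) → adj G x y ≡ true

-- Give each old vertex cost 0 and each new vertex cost L. Every edge of G_m weighs at least
-- the sum of the costs of its ends, with equality on everything but non-edges, so every tour
-- weighs at least 2mL and a tour without non-edges attains this bound; in particular it is
-- 2-optimal. Conversely, as m > |V|, some tour edge {s, s'} joins two new vertices, and if
-- the tour also uses a non-edge {x, y}, the 2-change to {x, s}, {y, s'} lowers the weight
-- by M > 0. That 2-change is realised by reversing the stretch of the tour between the two
-- removed edges.
module Submission where

open import Defs
open import Data.Nat using (ℕ; suc; _*_; _≤_; _<_)
open import Function.Bundles using (_⇔_; mk⇔; Bijection)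

open import Data.Nat as ℕ using (zero; _+_; _∸_; pred; z≤n; s≤s; z<s; _≤?_)
open import Data.Nat.Properties hiding (_≟_)
open import Data.Nat.ListAction using () renaming (sum to listSum)
open import Data.Fin as Fin using (Fin; zero; suc; toℕ; fromℕ<; fromℕ; inject₁; _≟_)
open import Data.Fin.Properties
  using (toℕ-injective; toℕ-fromℕ<; toℕ<n; toℕ-fromℕ; toℕ-inject₁; punchInᵢ≢i; pigeonhole)
open import Data.Fin.Permutation using (permutation)
open import Data.List using (tabulate)
open import Data.Sum using (_⊎_; inj₁; inj₂; [_,_]′)
open import Data.Sum.Properties using (inj₂-injective)
open import Data.Bool using (true; false; if_then_else_)
open import Data.Product using (∃; ∃₂; _×_; _,_; proj₁; proj₂)
open import Data.Vec.Functional using (removeAt; updateAt)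
open import Data.Vec.Functional.Properties using (updateAt-updates; updateAt-minimal)
open import Function.Base using (_∘_)
open import Function.Definitions using (Injective; Bijective)
open import Function.Properties.Inverse using (Inverse⇒Bijection)
import Function.Construct.Composition as Compose
open import Relation.Binary.PropositionalEquality as ≡
  using (_≡_; _≢_; refl; trans; cong; cong₂; subst; subst₂; module ≡-Reasoning)
open import Relation.Nullary using (¬_; yes; no; contradiction)
open import Relation.Binary.Definitions using (tri<; tri≈; tri>)
open import Relation.Nullary.Decidable using (_×-dec_)
open import Algebra.Properties.CommutativeMonoid.Sum +-0-commutativeMonoid
  using (sum-cong-≗; sum-remove; sum-permute; ∑-distrib-+; sum-syntax)
  renaming (sum to ∑)
open import Algebra.Properties.CommutativeSemigroup +-commutativeSemigroup
  using (xy∙z≈xz∙y)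

SameEdge-sym : ∀ {A : Set} {u v a b : A} → SameEdge u v a b → SameEdge a b u v
SameEdge-sym (inj₁ (refl , refl)) = inj₁ (refl , refl)
SameEdge-sym (inj₂ (refl , refl)) = inj₂ (refl , refl)

SameEdge-trans : ∀ {A : Set} {u v a b c d : A} →
                 SameEdge u v a b → SameEdge a b c d → SameEdge u v c d
SameEdge-trans (inj₁ (refl , refl)) e = e
SameEdge-trans (inj₂ (refl , refl)) (inj₁ (refl , refl)) = inj₂ (refl , refl)
SameEdge-trans (inj₂ (refl , refl)) (inj₂ (refl , refl)) = inj₁ (refl , refl)

SameEdge-map : ∀ {A B : Set} (f : A → B) {u v a b : A} →
               SameEdge u v a b → SameEdge (f u) (f v) (f a) (f b)
SameEdge-map f (inj₁ (refl , refl)) = inj₁ (refl , refl)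
SameEdge-map f (inj₂ (refl , refl)) = inj₂ (refl , refl)

SameEdge-weight : ∀ {A : Set} (w : A → A → ℕ) → (∀ u v → w u v ≡ w v u) →
                  ∀ {u v a b} → SameEdge u v a b → w u v ≡ w a b
SameEdge-weight w w-sym (inj₁ (refl , refl)) = refl
SameEdge-weight w w-sym (inj₂ (refl , refl)) = w-sym _ _

sum-tabulate : ∀ {K} (f : Fin K → ℕ) → listSum (tabulate f) ≡ ∑[ r < K ] f r
sum-tabulate {zero}  f = refl
sum-tabulate {suc K} f = cong (f zero +_) (sum-tabulate (f ∘ suc))

∑-mono-≤ : ∀ {K} {f g : Fin K → ℕ} → (∀ r → f r ≤ g r) → ∑ f ≤ ∑ g
∑-mono-≤ {zero}  _   = z≤n
∑-mono-≤ {suc K} f≤g = +-mono-≤ (f≤g zero) (∑-mono-≤ (f≤g ∘ suc))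

∑-reindex : ∀ {K} (f : Fin K → ℕ) {π π⁻¹ : Fin K → Fin K} →
            (∀ r → π (π⁻¹ r) ≡ r) → (∀ r → π⁻¹ (π r) ≡ r) → ∑ (f ∘ π) ≡ ∑ f
∑-reindex f inv inv′ = ≡.sym (sum-permute f (permutation _ _ inv inv′))

∑-update : ∀ {K} {f g : Fin K → ℕ} (i : Fin K) →
           (∀ r → r ≢ i → f r ≡ g r) → ∑ f + g i ≡ ∑ g + f i
∑-update {suc K} {f} {g} i f≡g = begin
  ∑ f + g i                       ≡⟨ cong (_+ g i) (sum-remove f) ⟩
  f i + ∑ (removeAt f i) + g i    ≡⟨ cong (λ s → f i + s + g i) (sum-cong-≗ (λ j → f≡g _ (punchInᵢ≢i i j))) ⟩
  f i + ∑ (removeAt g i) + g i    ≡⟨ swap-outer (f i) _ (g i) ⟩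
  g i + ∑ (removeAt g i) + f i    ≡⟨ cong (_+ f i) (sum-remove g) ⟨
  ∑ g + f i                       ∎
  where
  open ≡-Reasoning
  swap-outer : ∀ x y z → x + y + z ≡ z + y + x
  swap-outer x y z = trans (+-comm (x + y) z) (trans (cong (z +_) (+-comm x y)) (≡.sym (+-assoc z y x)))

∑-update₂ : ∀ {K} {f g : Fin K → ℕ} {i j : Fin K} → i ≢ j →
            (∀ r → r ≢ i → r ≢ j → f r ≡ g r) → ∑ f + (g i + g j) ≡ ∑ g + (f i + f j)
∑-update₂ {K} {f} {g} {i} {j} i≢j f≡g = begin
  ∑ f + (g i + g j)  ≡⟨ +-assoc (∑ f) (g i) (g j) ⟨
  ∑ f + g i + g j    ≡⟨ cong (λ x → ∑ f + x + g j) h-on ⟨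
  ∑ f + h i + g j    ≡⟨ cong (_+ g j) (∑-update i f≡h) ⟩
  ∑ h + f i + g j    ≡⟨ xy∙z≈xz∙y (∑ h) (f i) (g j) ⟩
  ∑ h + g j + f i    ≡⟨ cong (_+ f i) (∑-update j h≡g) ⟩
  ∑ g + h j + f i    ≡⟨ cong (λ x → ∑ g + x + f i) (h-off (i≢j ∘ ≡.sym)) ⟩
  ∑ g + f j + f i    ≡⟨ xy∙z≈xz∙y (∑ g) (f j) (f i) ⟩
  ∑ g + f i + f j    ≡⟨ +-assoc (∑ g) (f i) (f j) ⟩
  ∑ g + (f i + f j)  ∎
  where
  open ≡-Reasoning
  h : Fin K → ℕ
  h = updateAt f i (λ _ → g i)
  h-on : h i ≡ g i
  h-on = updateAt-updates i f
  h-off : ∀ {r} → r ≢ i → h r ≡ f r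
  h-off {r} r≢i = updateAt-minimal r i f r≢i
  f≡h : ∀ r → r ≢ i → f r ≡ h r
  f≡h r r≢i = ≡.sym (h-off r≢i)
  h≡g : ∀ r → r ≢ j → h r ≡ g r
  h≡g r r≢j with r ≟ i
  ... | yes refl = h-on
  ... | no  r≢i  = trans (h-off r≢i) (f≡g r r≢i r≢j)

csuc-view : ∀ {K} (i : Fin K) →
            (suc (toℕ i) ≡ K × toℕ (csuc i) ≡ 0) ⊎ (suc (toℕ i) < K × toℕ (csuc i) ≡ suc (toℕ i))
csuc-view {suc k} i with toℕ i ℕ.≟ k
... | yes i≡k = inj₁ (cong suc i≡k , refl)
... | no  i≢k = inj₂ (s≤s i<k , toℕ-fromℕ< (s≤s i<k))
  where
  i<k : toℕ i < k
  i<k = ≤∧≢⇒< (ℕ.s≤s⁻¹ (toℕ<n i)) i≢k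

toℕ-csuc : ∀ {K} (i : Fin K) → suc (toℕ i) < K → toℕ (csuc i) ≡ suc (toℕ i)
toℕ-csuc i 1+i<K with csuc-view i
... | inj₁ (1+i≡K , _) = contradiction 1+i≡K (<⇒≢ 1+i<K)
... | inj₂ (_ , eq)    = eq

csuc-injective : ∀ {K} → Injective {A = Fin K} _≡_ _≡_ csuc
csuc-injective {x = i} {j} ci≡cj with csuc-view i | csuc-view j
... | inj₁ (i-last , _)  | inj₁ (j-last , _)  = toℕ-injective (suc-injective (trans i-last (≡.sym j-last)))
... | inj₁ (_ , ci≡0)    | inj₂ (_ , cj≡1+j)  =
  contradiction (trans (≡.sym ci≡0) (trans (cong toℕ ci≡cj) cj≡1+j)) 0≢1+n
... | inj₂ (_ , ci≡1+i)  | inj₁ (_ , cj≡0)    =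
  contradiction (trans (≡.sym cj≡0) (trans (cong toℕ (≡.sym ci≡cj)) ci≡1+i)) 0≢1+n
... | inj₂ (_ , ci≡1+i)  | inj₂ (_ , cj≡1+j)  =
  toℕ-injective (suc-injective (trans (≡.sym ci≡1+i) (trans (cong toℕ ci≡cj) cj≡1+j)))

cpred : ∀ {K} → Fin K → Fin K
cpred {suc k} zero    = fromℕ k
cpred {suc k} (suc i) = inject₁ i

csuc-cpred : ∀ {K} (i : Fin K) → csuc (cpred i) ≡ i
csuc-cpred {suc k} zero with csuc-view (fromℕ k)
... | inj₁ (_ , c≡0)      = toℕ-injective c≡0
... | inj₂ (1+k<1+k , _)  = contradiction (subst (λ x → suc x < suc k) (toℕ-fromℕ k) 1+k<1+k) (<-irrefl refl)
csuc-cpred {suc k} (suc i) = toℕ-injective (begin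
  toℕ (csuc (inject₁ i))  ≡⟨ toℕ-csuc (inject₁ i) (s≤s (subst (_< k) (≡.sym (toℕ-inject₁ i)) (toℕ<n i))) ⟩
  suc (toℕ (inject₁ i))   ≡⟨ cong suc (toℕ-inject₁ i) ⟩
  suc (toℕ i)             ∎)
  where open ≡-Reasoning

cpred-csuc : ∀ {K} (i : Fin K) → cpred (csuc i) ≡ i
cpred-csuc i = csuc-injective (csuc-cpred (csuc i))

csuc²≡id⇒≤2 : ∀ {K} (i : Fin K) → csuc (csuc i) ≡ i → K ≤ 2
csuc²≡id⇒≤2 {K} i eq with csuc-view i | csuc-view (csuc i)
... | inj₁ (_ , ci≡0)      | inj₁ (ci-last , _) =
  ≤-trans (≤-reflexive (trans (≡.sym ci-last) (cong suc ci≡0))) (n≤1+n 1)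
... | inj₁ (i-last , ci≡0) | inj₂ (_ , cci≡1+ci) =
  ≤-reflexive (trans (≡.sym i-last) (cong suc (trans (≡.sym (cong toℕ eq)) (trans cci≡1+ci (cong suc ci≡0)))))
... | inj₂ (_ , ci≡1+i)    | inj₁ (ci-last , cci≡0) =
  ≤-reflexive (trans (≡.sym ci-last) (cong suc (trans ci≡1+i (cong suc (trans (≡.sym (cong toℕ eq)) cci≡0)))))
... | inj₂ (_ , ci≡1+i)    | inj₂ (_ , cci≡1+ci) =
  contradiction (trans (≡.sym (cong toℕ eq)) (trans cci≡1+ci (cong suc ci≡1+i)))
                (<⇒≢ (m≤n⇒m≤1+n (n<1+n (toℕ i))))

edge-position-unique : ∀ {K} {A : Set} {t : Fin K → A} → Injective _≡_ _≡_ t → 2 < K →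
                       ∀ {i j} → SameEdge (t i) (t (csuc i)) (t j) (t (csuc j)) → i ≡ j
edge-position-unique t-inj 2<K (inj₁ (ti≡tj , _)) = t-inj ti≡tj
edge-position-unique {t = t} t-inj 2<K {i} {j} (inj₂ (ti≡tcj , tci≡tj)) =
  contradiction (csuc²≡id⇒≤2 j (trans (cong csuc (≡.sym (t-inj ti≡tcj))) (t-inj tci≡tj))) (<⇒≱ 2<K)

-- Reflecting a segment of positions

reflect : ℕ → ℕ → ℕ → ℕ
reflect a b k with a ≤? k ×-dec k ≤? b
... | yes _ = a + b ∸ k
... | no  _ = k

module _ {a b k : ℕ} where

  reflect-inside : a ≤ k → k ≤ b → reflect a b k ≡ a + b ∸ k
  reflect-inside a≤k k≤b with a ≤? k ×-dec k ≤? b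
  ... | yes _  = refl
  ... | no  ∉ = contradiction (a≤k , k≤b) ∉

  reflect-outside : ¬ (a ≤ k × k ≤ b) → reflect a b k ≡ k
  reflect-outside ∉ with a ≤? k ×-dec k ≤? b
  ... | yes ∈ = contradiction ∈ ∉
  ... | no  _ = refl

  reflect-below : k < a → reflect a b k ≡ k
  reflect-below k<a = reflect-outside (λ (a≤k , _) → <⇒≱ k<a a≤k)

  reflect-above : b < k → reflect a b k ≡ k
  reflect-above b<k = reflect-outside (λ (_ , k≤b) → <⇒≱ b<k k≤b)

  reflected-bounds : a ≤ k → k ≤ b → a ≤ a + b ∸ k × a + b ∸ k ≤ b
  reflected-bounds a≤k k≤b =
    subst (_≤ a + b ∸ k) (m+n∸n≡m a b) (∸-monoʳ-≤ (a + b) k≤b) ,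
    subst (a + b ∸ k ≤_) (m+n∸m≡n k b) (∸-monoˡ-≤ k (+-monoˡ-≤ b a≤k))

  reflect-≤ : k ≤ b → reflect a b k ≤ b
  reflect-≤ k≤b with a ≤? k ×-dec k ≤? b
  ... | yes (a≤k , _) = proj₂ (reflected-bounds a≤k k≤b)
  ... | no  _         = k≤b

  reflect-< : ∀ {K} → b < K → k < K → reflect a b k < K
  reflect-< {K} b<K k<K =
    [ (λ k≤b → ≤-<-trans (reflect-≤ k≤b) b<K)
    , (λ b<k → subst (_< K) (≡.sym (reflect-above b<k)) k<K)
    ]′ (≤-<-connex k b)


reflect-involutive : ∀ a b k → reflect a b (reflect a b k) ≡ k
reflect-involutive a b k with a ≤? k ×-dec k ≤? b
... | yes (a≤k , k≤b)
  with a≤a+b∸k , a+b∸k≤b ← reflected-bounds a≤k k≤b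
  = trans (reflect-inside a≤a+b∸k a+b∸k≤b) (m∸[m∸n]≡n (≤-trans k≤b (m≤n+m b a)))
... | no  ∉ = reflect-outside ∉

reflect-shift : ∀ {a b k} → a ≤ k → k < b →
                reflect a b k ≡ suc (reflect a (pred b) k) × reflect a b (suc k) ≡ reflect a (pred b) k
reflect-shift {a} {suc b} {k} a≤k (s≤s k≤b) = at-k , at-suc-k
  where
  open ≡-Reasoning
  at-k : reflect a (suc b) k ≡ suc (reflect a b k)
  at-k = begin
    reflect a (suc b) k    ≡⟨ reflect-inside a≤k (m≤n⇒m≤1+n k≤b) ⟩
    a + suc b ∸ k          ≡⟨ cong (_∸ k) (+-suc a b) ⟩
    suc (a + b) ∸ k        ≡⟨ +-∸-assoc 1 (≤-trans k≤b (m≤n+m b a)) ⟩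
    suc (a + b ∸ k)        ≡⟨ cong suc (reflect-inside a≤k k≤b) ⟨
    suc (reflect a b k)    ∎
  at-suc-k : reflect a (suc b) (suc k) ≡ reflect a b k
  at-suc-k = begin
    reflect a (suc b) (suc k)  ≡⟨ reflect-inside (m≤n⇒m≤1+n a≤k) (s≤s k≤b) ⟩
    a + suc b ∸ suc k          ≡⟨ cong (_∸ suc k) (+-suc a b) ⟩
    a + b ∸ k                  ≡⟨ reflect-inside a≤k k≤b ⟨
    reflect a b k              ∎

module ReflectFin {K : ℕ} (a b : ℕ) (b<K : b < K) where

  reflectFin : Fin K → Fin K
  reflectFin k = fromℕ< (reflect-< {a} b<K (toℕ<n k))

  toℕ-reflectFin : ∀ k → toℕ (reflectFin k) ≡ reflect a b (toℕ k)
  toℕ-reflectFin k = toℕ-fromℕ< _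

  reflectFin-involutive : ∀ k → reflectFin (reflectFin k) ≡ k
  reflectFin-involutive k = toℕ-injective (begin
    toℕ (reflectFin (reflectFin k))    ≡⟨ toℕ-reflectFin (reflectFin k) ⟩
    reflect a b (toℕ (reflectFin k))   ≡⟨ cong (reflect a b) (toℕ-reflectFin k) ⟩
    reflect a b (reflect a b (toℕ k))  ≡⟨ reflect-involutive a b (toℕ k) ⟩
    toℕ k                              ∎)
    where open ≡-Reasoning

  reflectFin-below : ∀ {k} → toℕ k < a → reflectFin k ≡ k
  reflectFin-below k<a = toℕ-injective (trans (toℕ-reflectFin _) (reflect-below {b = b} k<a))

  reflectFin-above : ∀ {k} → b < toℕ k → reflectFin k ≡ k
  reflectFin-above b<k = toℕ-injective (trans (toℕ-reflectFin _) (reflect-above {a} b<k))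

pred-< : ∀ {n} → 0 < n → pred n < n
pred-< {suc n} _ = n<1+n n

module SegmentReversal {K : ℕ} (p q : Fin K) (p<q : toℕ p < toℕ q) where

  -- ρ reverses the positions p+1 … q; σ reverses the indices p+1 … q-1 of the edges strictly
  -- between the two removed ones, so that the edge at r ∉ {p, q} after the reversal is the
  -- edge at σ r before it (ρ-edge).
  module Positions = ReflectFin (suc (toℕ p)) (toℕ q) (toℕ<n q)
  module Edges     = ReflectFin (suc (toℕ p)) (pred (toℕ q)) (≤-<-trans pred[n]≤n (toℕ<n q))

  ρ σ : Fin K → Fin K
  ρ = Positions.reflectFin
  σ = Edges.reflectFin

  ρ-involutive : ∀ r → ρ (ρ r) ≡ r
  ρ-involutive = Positions.reflectFin-involutive

  ρ-bijective : Bijective _≡_ _≡_ ρ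
  ρ-bijective = Bijection.bijective (Inverse⇒Bijection (permutation ρ ρ ρ-involutive ρ-involutive))

  σ-involutive : ∀ r → σ (σ r) ≡ r
  σ-involutive = Edges.reflectFin-involutive

  toℕ-csuc-p : toℕ (csuc p) ≡ suc (toℕ p)
  toℕ-csuc-p = toℕ-csuc p (≤-<-trans p<q (toℕ<n q))

  ρ-p : ρ p ≡ p
  ρ-p = Positions.reflectFin-below (n<1+n (toℕ p))

  σ-p : σ p ≡ p
  σ-p = Edges.reflectFin-below (n<1+n (toℕ p))

  ρ-csuc-p : ρ (csuc p) ≡ q
  ρ-csuc-p = toℕ-injective (begin
    toℕ (ρ (csuc p))                              ≡⟨ Positions.toℕ-reflectFin (csuc p) ⟩
    reflect (suc (toℕ p)) (toℕ q) (toℕ (csuc p))  ≡⟨ cong (reflect (suc (toℕ p)) (toℕ q)) toℕ-csuc-p ⟩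
    reflect (suc (toℕ p)) (toℕ q) (suc (toℕ p))   ≡⟨ reflect-inside ≤-refl p<q ⟩
    suc (toℕ p) + toℕ q ∸ suc (toℕ p)             ≡⟨ m+n∸m≡n (suc (toℕ p)) (toℕ q) ⟩
    toℕ q                                         ∎)
    where open ≡-Reasoning

  ρ-q : ρ q ≡ csuc p
  ρ-q = trans (cong ρ (≡.sym ρ-csuc-p)) (ρ-involutive (csuc p))

  ρ-csuc-q : ρ (csuc q) ≡ csuc q
  ρ-csuc-q with csuc-view q
  ... | inj₁ (_ , cq≡0)   = Positions.reflectFin-below (subst (_< suc (toℕ p)) (≡.sym cq≡0) z<s)
  ... | inj₂ (_ , cq≡1+q) = Positions.reflectFin-above (subst (toℕ q <_) (≡.sym cq≡1+q) (n<1+n (toℕ q)))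

  σ-q : σ q ≡ q
  σ-q = Edges.reflectFin-above (pred-< (≤-<-trans z≤n p<q))

  private
    fixed-edge : ∀ {r} → ρ r ≡ r → σ r ≡ r → ρ (csuc r) ≡ csuc r →
                 SameEdge (ρ r) (ρ (csuc r)) (σ r) (csuc (σ r))
    fixed-edge ρr≡r σr≡r ρcr≡cr = inj₁ (trans ρr≡r (≡.sym σr≡r) , trans ρcr≡cr (cong csuc (≡.sym σr≡r)))

    before-segment : ∀ {r} → toℕ r < toℕ p → SameEdge (ρ r) (ρ (csuc r)) (σ r) (csuc (σ r))
    before-segment {r} r<p = fixed-edge (Positions.reflectFin-below r<1+p) (Edges.reflectFin-below r<1+p)
      (Positions.reflectFin-below
        (subst (_< suc (toℕ p)) (≡.sym (toℕ-csuc r (≤-<-trans r<p (toℕ<n p)))) (s≤s r<p)))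
      where r<1+p = m<n⇒m<1+n r<p

    after-segment : ∀ {r} → toℕ q < toℕ r → SameEdge (ρ r) (ρ (csuc r)) (σ r) (csuc (σ r))
    after-segment {r} q<r = fixed-edge (Positions.reflectFin-above q<r) (Edges.reflectFin-above (≤-<-trans pred[n]≤n q<r))
      ρcr≡cr
      where
      ρcr≡cr : ρ (csuc r) ≡ csuc r
      ρcr≡cr with csuc-view r
      ... | inj₁ (_ , cr≡0)   = Positions.reflectFin-below (subst (_< suc (toℕ p)) (≡.sym cr≡0) z<s)
      ... | inj₂ (_ , cr≡1+r) = Positions.reflectFin-above (subst (toℕ q <_) (≡.sym cr≡1+r) (m<n⇒m<1+n q<r))

    inside-segment : ∀ {r} → toℕ p < toℕ r → toℕ r < toℕ q → SameEdge (ρ r) (ρ (csuc r)) (σ r) (csuc (σ r))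
    inside-segment {r} p<r r<q = inj₂ (toℕ-injective ρr≡cσr , toℕ-injective ρcr≡σr)
      where
      open ≡-Reasoning
      shift : reflect (suc (toℕ p)) (toℕ q) (toℕ r) ≡ suc (reflect (suc (toℕ p)) (pred (toℕ q)) (toℕ r))
            × reflect (suc (toℕ p)) (toℕ q) (suc (toℕ r)) ≡ reflect (suc (toℕ p)) (pred (toℕ q)) (toℕ r)
      shift = reflect-shift p<r r<q
      ρr≡1+σr : toℕ (ρ r) ≡ suc (toℕ (σ r))
      ρr≡1+σr = begin
        toℕ (ρ r)                                         ≡⟨ Positions.toℕ-reflectFin r ⟩
        reflect (suc (toℕ p)) (toℕ q) (toℕ r)             ≡⟨ proj₁ shift ⟩
        suc (reflect (suc (toℕ p)) (pred (toℕ q)) (toℕ r)) ≡⟨ cong suc (Edges.toℕ-reflectFin r) ⟨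
        suc (toℕ (σ r))                                   ∎
      ρr≡cσr : toℕ (ρ r) ≡ toℕ (csuc (σ r))
      ρr≡cσr = trans ρr≡1+σr (≡.sym (toℕ-csuc (σ r) (subst (_< K) ρr≡1+σr (toℕ<n (ρ r)))))
      ρcr≡σr : toℕ (ρ (csuc r)) ≡ toℕ (σ r)
      ρcr≡σr = begin
        toℕ (ρ (csuc r))                                   ≡⟨ Positions.toℕ-reflectFin (csuc r) ⟩
        reflect (suc (toℕ p)) (toℕ q) (toℕ (csuc r))       ≡⟨ cong (reflect (suc (toℕ p)) (toℕ q))
                                                                   (toℕ-csuc r (≤-<-trans r<q (toℕ<n q))) ⟩
        reflect (suc (toℕ p)) (toℕ q) (suc (toℕ r))        ≡⟨ proj₂ shift ⟩
        reflect (suc (toℕ p)) (pred (toℕ q)) (toℕ r)       ≡⟨ Edges.toℕ-reflectFin r ⟨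
        toℕ (σ r)                                          ∎

  ρ-edge : ∀ r → r ≢ p → r ≢ q → SameEdge (ρ r) (ρ (csuc r)) (σ r) (csuc (σ r))
  ρ-edge r r≢p r≢q with <-cmp (toℕ r) (toℕ p)
  ... | tri< r<p _ _    = before-segment r<p
  ... | tri≈ _ r≡p _    = contradiction (toℕ-injective r≡p) r≢p
  ... | tri> _ _ p<r with <-cmp (toℕ r) (toℕ q)
  ...   | tri< r<q _ _  = inside-segment p<r r<q
  ...   | tri≈ _ r≡q _  = contradiction (toℕ-injective r≡q) r≢q
  ...   | tri> _ _ q<r  = after-segment q<r

-- The 2-change reversing a segment of the tour

module ReversalTwoChange {n m : ℕ} (T : Tour n m) (p q : Fin (n + m)) (p<q : toℕ p < toℕ q)
                         (q≢csuc-p : q ≢ csuc p) (csuc-q≢p : csuc q ≢ p) where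

  open SegmentReversal p q p<q

  t : Fin (n + m) → Vertex n m
  t = proj₁ T

  t-injective : Injective _≡_ _≡_ t
  t-injective = proj₁ (proj₂ T)

  T′ : Tour n m
  T′ = t ∘ ρ , Compose.bijective _≡_ _≡_ _≡_ ρ-bijective (proj₂ T)

  t′ : Fin (n + m) → Vertex n m
  t′ = proj₁ T′

  a b c d : Vertex n m
  a = t p
  b = t (csuc p)
  c = t q
  d = t (csuc q)

  2<n+m : 2 < n + m
  2<n+m = ≤-<-trans (≤-trans (s≤s (s≤s z≤n)) 1+p<q) (toℕ<n q)
    where
    1+p<q : suc (toℕ p) < toℕ q
    1+p<q = ≤∧≢⇒< p<q (λ 1+p≡q → q≢csuc-p (toℕ-injective (trans (≡.sym 1+p≡q) (≡.sym toℕ-csuc-p))))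

  edge-at-p : SameEdge (t′ p) (t′ (csuc p)) a c
  edge-at-p = inj₁ (cong t ρ-p , cong t ρ-csuc-p)

  edge-at-q : SameEdge (t′ q) (t′ (csuc q)) b d
  edge-at-q = inj₁ (cong t ρ-q , cong t ρ-csuc-q)

  edge-elsewhere : ∀ {r} → r ≢ p → r ≢ q → SameEdge (t′ r) (t′ (csuc r)) (t (σ r)) (t (csuc (σ r)))
  edge-elsewhere {r} r≢p r≢q = SameEdge-map t (ρ-edge r r≢p r≢q)

  σ-fixed-preimage : ∀ {r s} → σ s ≡ s → σ r ≡ s → r ≡ s
  σ-fixed-preimage {r} σs≡s σr≡s = trans (≡.sym (σ-involutive r)) (trans (cong σ σr≡s) σs≡s)

  EdgeAfterChange : Vertex n m → Vertex n m → Set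
  EdgeAfterChange u v =
    (TEdge T u v × ¬ SameEdge u v a b × ¬ SameEdge u v c d) ⊎ SameEdge u v a c ⊎ SameEdge u v b d

  edges-of-T′ : ∀ u v → TEdge T′ u v ⇔ EdgeAfterChange u v
  edges-of-T′ u v = mk⇔ to from
    where
    to : TEdge T′ u v → EdgeAfterChange u v
    to (r , r-edge) with r ≟ p | r ≟ q
    ... | yes refl | _        = inj₂ (inj₁ (SameEdge-sym (SameEdge-trans (SameEdge-sym edge-at-p) r-edge)))
    ... | no  _    | yes refl = inj₂ (inj₂ (SameEdge-sym (SameEdge-trans (SameEdge-sym edge-at-q) r-edge)))
    ... | no  r≢p  | no  r≢q  =
      inj₁ ((σ r , old-edge) , r≢p ∘ σ-fixed-preimage σ-p ∘ same-position
                             , r≢q ∘ σ-fixed-preimage σ-q ∘ same-position)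
      where
      old-edge : SameEdge (t (σ r)) (t (csuc (σ r))) u v
      old-edge = SameEdge-trans (SameEdge-sym (edge-elsewhere r≢p r≢q)) r-edge
      same-position : ∀ {s} → SameEdge u v (t s) (t (csuc s)) → σ r ≡ s
      same-position uv≈s = edge-position-unique t-injective 2<n+m (SameEdge-trans old-edge uv≈s)
    from : EdgeAfterChange u v → TEdge T′ u v
    from (inj₂ (inj₁ uv≈ac)) = p , SameEdge-trans edge-at-p (SameEdge-sym uv≈ac)
    from (inj₂ (inj₂ uv≈bd)) = q , SameEdge-trans edge-at-q (SameEdge-sym uv≈bd)
    from (inj₁ ((r , r-edge) , uv≉ab , uv≉cd)) = σ r , SameEdge-trans new-edge r-edge
      where
      not-removed : ∀ {s} → σ s ≡ s → ¬ SameEdge u v (t s) (t (csuc s)) → σ r ≢ s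
      not-removed σs≡s uv≉s σr≡s with refl ← σ-fixed-preimage {r} σs≡s σr≡s = uv≉s (SameEdge-sym r-edge)
      new-edge : SameEdge (t′ (σ r)) (t′ (csuc (σ r))) (t r) (t (csuc r))
      new-edge = subst (λ s → SameEdge (t′ (σ r)) (t′ (csuc (σ r))) (t s) (t (csuc s))) (σ-involutive r)
                   (edge-elsewhere (not-removed σ-p uv≉ab) (not-removed σ-q uv≉cd))

  twoChange : TwoChange T T′
  twoChange = a , b , c , d , (p , inj₁ (refl , refl)) , (q , inj₁ (refl , refl)) ,
              <⇒≢ p<q ∘ cong toℕ ∘ t-injective ,
              csuc-q≢p ∘ ≡.sym ∘ t-injective ,
              q≢csuc-p ∘ ≡.sym ∘ t-injective ,
              <⇒≢ p<q ∘ cong toℕ ∘ csuc-injective ∘ t-injective ,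
              ¬ac , ¬bd , edges-of-T′
    where
    ¬ac : ¬ TEdge T a c
    ¬ac (r , inj₁ (tr≡a , tcr≡c)) = q≢csuc-p (trans (≡.sym (t-injective tcr≡c)) (cong csuc (t-injective tr≡a)))
    ¬ac (r , inj₂ (tr≡c , tcr≡a)) = csuc-q≢p (trans (cong csuc (≡.sym (t-injective tr≡c))) (t-injective tcr≡a))
    ¬bd : ¬ TEdge T b d
    ¬bd (r , inj₁ (tr≡b , tcr≡d)) = q≢csuc-p (trans (≡.sym (csuc-injective (t-injective tcr≡d))) (t-injective tr≡b))
    ¬bd (r , inj₂ (tr≡d , tcr≡b)) = csuc-q≢p (trans (≡.sym (t-injective tr≡d)) (csuc-injective (t-injective tcr≡b)))

  module _ (w : Vertex n m → Vertex n m → ℕ) (w-sym : ∀ u v → w u v ≡ w v u) where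

    tourWeight-T′ : tourWeight w T′ + (w a b + w c d) ≡ tourWeight w T + (w a c + w b d)
    tourWeight-T′ = begin
      tourWeight w T′ + (w a b + w c d)        ≡⟨ cong (_+ (w a b + w c d)) (sum-tabulate F′) ⟩
      ∑ F′ + (w a b + w c d)                   ≡⟨ cong₂ (λ x y → ∑ F′ + (x + y)) (cong F σ-p) (cong F σ-q) ⟨
      ∑ F′ + (F (σ p) + F (σ q))               ≡⟨ ∑-update₂ (<⇒≢ p<q ∘ cong toℕ) F′≡F∘σ ⟩
      ∑ (F ∘ σ) + (F′ p + F′ q)                ≡⟨ cong (_+ (F′ p + F′ q)) (∑-reindex F {σ} {σ} σ-involutive σ-involutive) ⟩
      ∑ F + (F′ p + F′ q)                      ≡⟨ cong (_+ (F′ p + F′ q)) (sum-tabulate F) ⟨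
      tourWeight w T + (F′ p + F′ q)           ≡⟨ cong₂ (λ x y → tourWeight w T + (x + y))
                                                        (SameEdge-weight w w-sym edge-at-p)
                                                        (SameEdge-weight w w-sym edge-at-q) ⟩
      tourWeight w T + (w a c + w b d)         ∎
      where
      open ≡-Reasoning
      F F′ : Fin (n + m) → ℕ
      F  r = w (t r) (t (csuc r))
      F′ r = w (t′ r) (t′ (csuc r))
      F′≡F∘σ : ∀ r → r ≢ p → r ≢ q → F′ r ≡ F (σ r)
      F′≡F∘σ r r≢p r≢q = SameEdge-weight w w-sym (edge-elsewhere r≢p r≢q)

reversal-improves : ∀ {n m} (w : Vertex n m → Vertex n m → ℕ) → (∀ u v → w u v ≡ w v u) →
  (T : Tour n m) (p q : Fin (n + m)) → toℕ p < toℕ q → q ≢ csuc p → csuc q ≢ p →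
  let t = proj₁ T in
  w (t p) (t q) + w (t (csuc p)) (t (csuc q)) < w (t p) (t (csuc p)) + w (t q) (t (csuc q)) →
  ¬ TwoOptimal w T
reversal-improves w w-sym T p q p<q q≢csuc-p csuc-q≢p gain optimal =
  optimal T′ twoChange (+-cancelʳ-< _ (tourWeight w T′) (tourWeight w T) (begin-strict
    tourWeight w T′ + (w a b + w c d)  ≡⟨ tourWeight-T′ w w-sym ⟩
    tourWeight w T + (w a c + w b d)   <⟨ +-monoʳ-< (tourWeight w T) gain ⟩
    tourWeight w T + (w a b + w c d)   ∎))
  where
  open ReversalTwoChange T p q p<q q≢csuc-p csuc-q≢p
  open ≤-Reasoning

improving-pair⇒¬twoOptimal : ∀ {n m} (w : Vertex n m → Vertex n m → ℕ) → (∀ u v → w u v ≡ w v u) →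
  (T : Tour n m) (p q : Fin (n + m)) → p ≢ q → q ≢ csuc p → p ≢ csuc q →
  let t = proj₁ T in
  w (t p) (t q) + w (t (csuc p)) (t (csuc q)) < w (t p) (t (csuc p)) + w (t q) (t (csuc q)) →
  ¬ TwoOptimal w T
improving-pair⇒¬twoOptimal {n} {m} w w-sym T p q p≢q q≢csuc-p p≢csuc-q gain with <-cmp (toℕ p) (toℕ q)
... | tri< p<q _ _ = reversal-improves w w-sym T p q p<q q≢csuc-p (p≢csuc-q ∘ ≡.sym) gain
... | tri≈ _ p≡q _ = contradiction (toℕ-injective p≡q) p≢q
... | tri> _ _ q<p = reversal-improves w w-sym T q p q<p p≢csuc-q (q≢csuc-p ∘ ≡.sym)
  (subst₂ _<_ (cong₂ _+_ (w-sym _ _) (w-sym _ _)) (+-comm (w (t p) (t (csuc p))) _) gain)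
  where
  t : Fin (n + m) → Vertex n m
  t = proj₁ T

-- Potentials and minimal tours

∑-edge-potential : ∀ {K} {A : Set} (h : A → ℕ) (t : Fin K → A) →
                   ∑[ r < K ] (h (t r) + h (t (csuc r))) ≡ ∑ (h ∘ t) + ∑ (h ∘ t)
∑-edge-potential h t =
  trans (∑-distrib-+ (h ∘ t) (h ∘ t ∘ csuc)) (cong (∑ (h ∘ t) +_) (∑-reindex (h ∘ t) csuc-cpred cpred-csuc))

position : ∀ {n m} → Tour n m → Vertex n m → Fin (n + m)
position (_ , _ , surjective) v = proj₁ (surjective v)

tour∘position : ∀ {n m} (T : Tour n m) v → proj₁ T (position T v) ≡ v
tour∘position (_ , _ , surjective) v = proj₂ (surjective v) refl

position∘tour : ∀ {n m} (T : Tour n m) r → position T (proj₁ T r) ≡ r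
position∘tour T r = proj₁ (proj₂ T) (tour∘position T (proj₁ T r))

∑-tour-invariant : ∀ {n m} (h : Vertex n m → ℕ) (T T′ : Tour n m) → ∑ (h ∘ proj₁ T′) ≡ ∑ (h ∘ proj₁ T)
∑-tour-invariant {n} {m} h T T′ = begin
  ∑ (h ∘ t′)          ≡⟨ sum-cong-≗ (λ r → cong h (tour∘position T (t′ r))) ⟨
  ∑ (h ∘ t ∘ π)       ≡⟨ ∑-reindex (h ∘ t) {π} {π⁻¹} (inverse T T′) (inverse T′ T) ⟩
  ∑ (h ∘ t)           ∎
  where
  open ≡-Reasoning
  t t′ : Fin (n + m) → Vertex n m
  t  = proj₁ T
  t′ = proj₁ T′
  π π⁻¹ : Fin (n + m) → Fin (n + m)
  π   = position T ∘ t′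
  π⁻¹ = position T′ ∘ t
  inverse : ∀ T T′ r → position T (proj₁ T′ (position T′ (proj₁ T r))) ≡ r
  inverse T T′ r = trans (cong (position T) (tour∘position T′ (proj₁ T r))) (position∘tour T r)

tight-potential⇒minimal : ∀ {n m} (w : Vertex n m → Vertex n m → ℕ) (h : Vertex n m → ℕ) →
  (∀ u v → h u + h v ≤ w u v) → (T : Tour n m) →
  (∀ r → w (proj₁ T r) (proj₁ T (csuc r)) ≡ h (proj₁ T r) + h (proj₁ T (csuc r))) →
  ∀ T′ → tourWeight w T ≤ tourWeight w T′
tight-potential⇒minimal {n} {m} w h h≤w T tight T′ = begin
  tourWeight w T                                         ≡⟨ sum-tabulate (λ r → w (t r) (t (csuc r))) ⟩
  ∑[ r < _ ] w (t r) (t (csuc r))                        ≡⟨ sum-cong-≗ tight ⟩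
  ∑[ r < _ ] (h (t r) + h (t (csuc r)))                  ≡⟨ ∑-edge-potential h t ⟩
  ∑ (h ∘ t) + ∑ (h ∘ t)                                  ≡⟨ cong₂ _+_ (∑-tour-invariant h T′ T) (∑-tour-invariant h T′ T) ⟩
  ∑ (h ∘ t′) + ∑ (h ∘ t′)                                ≡⟨ ∑-edge-potential h t′ ⟨
  ∑[ r < _ ] (h (t′ r) + h (t′ (csuc r)))                ≤⟨ ∑-mono-≤ (λ r → h≤w (t′ r) (t′ (csuc r))) ⟩
  ∑[ r < _ ] w (t′ r) (t′ (csuc r))                      ≡⟨ sum-tabulate (λ r → w (t′ r) (t′ (csuc r))) ⟨
  tourWeight w T′                                        ∎
  where
  open ≤-Reasoning
  t t′ : Fin (n + m) → Vertex n m
  t  = proj₁ T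
  t′ = proj₁ T′

-- If no two new vertices were consecutive, the old vertex after each new one would inject Fin m into Fin n.
consecutive-new-vertices : ∀ {n m} → n < m → (T : Tour n m) →
  ∃ λ j → ∃₂ λ s s′ → proj₁ T j ≡ inj₂ s × proj₁ T (csuc j) ≡ inj₂ s′
consecutive-new-vertices {zero} {suc m} _ T with proj₁ T zero in e | proj₁ T (csuc zero) in e′
... | inj₂ s | inj₂ s′ = zero , s , s′ , e , e′
consecutive-new-vertices {suc n} {m} n<m T = from-collision (pigeonhole n<m (old-part ∘ successor))
  where
  t : Fin (suc n + m) → Vertex (suc n) m
  t = proj₁ T
  successor : Fin m → Vertex (suc n) m
  successor s = t (csuc (position T (inj₂ s)))
  old-part : Vertex (suc n) m → Fin (suc n)
  old-part (inj₁ x) = x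
  old-part (inj₂ _) = zero
  successor-injective : Injective _≡_ _≡_ successor
  successor-injective {s₁} {s₂} eq = inj₂-injective (begin
    inj₂ s₁                  ≡⟨ tour∘position T (inj₂ s₁) ⟨
    t (position T (inj₂ s₁)) ≡⟨ cong t (csuc-injective (proj₁ (proj₂ T) eq)) ⟩
    t (position T (inj₂ s₂)) ≡⟨ tour∘position T (inj₂ s₂) ⟩
    inj₂ s₂                  ∎)
    where open ≡-Reasoning
  from-collision : (∃₂ λ s₁ s₂ → s₁ Fin.< s₂ × old-part (successor s₁) ≡ old-part (successor s₂)) →
                   ∃ λ j → ∃₂ λ s s′ → t j ≡ inj₂ s × t (csuc j) ≡ inj₂ s′
  from-collision (s₁ , s₂ , s₁<s₂ , same-old) with successor s₁ in e₁ | successor s₂ in e₂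
  ... | inj₂ s′ | _       = position T (inj₂ s₁) , s₁ , s′ , tour∘position T (inj₂ s₁) , e₁
  ... | inj₁ _  | inj₂ s′ = position T (inj₂ s₂) , s₂ , s′ , tour∘position T (inj₂ s₂) , e₂
  ... | inj₁ _  | inj₁ _  =
    contradiction (cong toℕ (successor-injective (trans e₁ (trans (cong inj₁ same-old) (≡.sym e₂)))))
                  (<⇒≢ s₁<s₂)

newVertexCost : ∀ {n m} → ℕ → Vertex n m → ℕ
newVertexCost L (inj₁ _) = 0
newVertexCost L (inj₂ _) = L

module _ {n m : ℕ} (G : SimpleGraph n) (L M : ℕ) where

  weight-sym : ∀ (u v : Vertex n m) → weight G L M u v ≡ weight G L M v u
  weight-sym (inj₁ x) (inj₁ y) = cong (if_then 0 else M) (sym G x y)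
  weight-sym (inj₁ _) (inj₂ _) = refl
  weight-sym (inj₂ _) (inj₁ _) = refl
  weight-sym (inj₂ _) (inj₂ _) = refl

  newVertexCost-≤-weight : ∀ (u v : Vertex n m) → newVertexCost L u + newVertexCost L v ≤ weight G L M u v
  newVertexCost-≤-weight (inj₁ _) (inj₁ _) = z≤n
  newVertexCost-≤-weight (inj₁ _) (inj₂ _) = ≤-refl
  newVertexCost-≤-weight (inj₂ _) (inj₁ _) = ≤-reflexive (+-identityʳ L)
  newVertexCost-≤-weight (inj₂ _) (inj₂ _) = ≤-reflexive (cong (L +_) (≡.sym (+-identityʳ L)))

  weight-tight : ∀ (u v : Vertex n m) → (∀ x y → u ≡ inj₁ x → v ≡ inj₁ y → adj G x y ≡ true) →
                 weight G L M u v ≡ newVertexCost L u + newVertexCost L v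
  weight-tight (inj₁ x) (inj₁ y) adjacent rewrite adjacent x y refl refl = refl
  weight-tight (inj₁ _) (inj₂ _) _ = refl
  weight-tight (inj₂ _) (inj₁ _) _ = ≡.sym (+-identityʳ L)
  weight-tight (inj₂ _) (inj₂ _) _ = cong (L +_) (+-identityʳ L)

  noNonEdge⇒twoOptimal : (T : Tour n m) → NoNonEdge G T → TwoOptimal (weight G L M) T
  noNonEdge⇒twoOptimal T no-non-edge T′ _ =
    ≤⇒≯ (tight-potential⇒minimal (weight G L M) (newVertexCost L) newVertexCost-≤-weight T tight T′)
    where
    tight : ∀ r → weight G L M (proj₁ T r) (proj₁ T (csuc r))
                  ≡ newVertexCost L (proj₁ T r) + newVertexCost L (proj₁ T (csuc r))
    tight r = weight-tight _ _ (λ x y tr≡x tcr≡y → no-non-edge x y (r , inj₁ (tr≡x , tcr≡y)))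

  non-edge⇒¬twoOptimal : n < m → 0 < M → (T : Tour n m) → ∀ i {x y} →
    proj₁ T i ≡ inj₁ x → proj₁ T (csuc i) ≡ inj₁ y → adj G x y ≡ false → ¬ TwoOptimal (weight G L M) T
  non-edge⇒¬twoOptimal n<m 0<M T i ti≡x tci≡y non-adjacent
    with j , s , s′ , tj≡s , tcj≡s′ ← consecutive-new-vertices n<m T =
    improving-pair⇒¬twoOptimal (weight G L M) weight-sym T i j
      (old≢new ti≡x tj≡s) (old≢new tci≡y tj≡s ∘ ≡.sym) (old≢new ti≡x tcj≡s′) gain
    where
    t : Fin (n + m) → Vertex n m
    t = proj₁ T
    old≢new : ∀ {r r′ x s} → t r ≡ inj₁ x → t r′ ≡ inj₂ s → r ≢ r′
    old≢new tr≡x tr′≡s refl with () ← trans (≡.sym tr≡x) tr′≡s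
    gain : weight G L M (t i) (t j) + weight G L M (t (csuc i)) (t (csuc j))
         < weight G L M (t i) (t (csuc i)) + weight G L M (t j) (t (csuc j))
    gain rewrite ti≡x | tci≡y | tj≡s | tcj≡s′ | non-adjacent =
      subst (_< M + 2 * L) (cong (L +_) (+-identityʳ L)) (+-monoˡ-< (2 * L) 0<M)

  twoOptimal⇒noNonEdge : n < m → 0 < M → (T : Tour n m) → TwoOptimal (weight G L M) T → NoNonEdge G T
  twoOptimal⇒noNonEdge n<m 0<M T optimal x y (i , tour-edge) with adj G x y in adjacency | tour-edge
  ... | true  | _ = refl
  ... | false | inj₁ (ti≡x , tci≡y) =
    contradiction optimal (non-edge⇒¬twoOptimal n<m 0<M T i ti≡x tci≡y adjacency)
  ... | false | inj₂ (ti≡y , tci≡x) =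
    contradiction optimal (non-edge⇒¬twoOptimal n<m 0<M T i ti≡y tci≡x (trans (sym G y x) adjacency))

lemma1 : ∀ (n : ℕ) (G : SimpleGraph n) (m : ℕ) → suc n ≤ m → m ≤ 2 * n →
         (L M : ℕ) → 2 * (2 * L) < M →
         (T : Tour n m) → TwoOptimal (weight {n} {m} G L M) T ⇔ NoNonEdge G T
lemma1 n G m n<m _ L M 4L<M T =
  mk⇔ (twoOptimal⇒noNonEdge G L M n<m (≤-<-trans z≤n 4L<M) T) (noNonEdge⇒twoOptimal G L M T)
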